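{- Let $q$ be a prime power, $b\ge 1$ an integer, and let $V\subset\mathbb{F}_q^b$ be a set of points with $\binom{|V|}{2}<q$. Then there exists an invertible linear transformation $T:\mathbb{F}_q^b\to\mathbb{F}_q^b$ such that $TV=\{Tx:x\in V\}$ is simple.
   Context: $\mathbb{F}_q$ is the finite field of order $q$. A set of points in $\mathbb{F}_q^b$ is called simple if the first coordinates of all its points are pairwise distinct. -}

module Defs where

open import Level using (Level; _⊔_)
open import Data.Nat using (ℕ; _≤_; _^_)
open import Data.Nat.Primality using (Prime)
open import Data.Fin using (Fin)
open import Data.Product using (Σ; _×_; ∃)
open import Data.Vec.Functional using (Vector)
open import Relation.Nullary using (¬_)
open import Relation.Binary.PropositionalEquality using (_≡_)
import Relation.Binary.PropositionalEquality as ≡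
open import Function.Bundles using (Bijection)
open import Algebra.Bundles using (CommutativeRing)

IsPrimePower : ℕ → Set
IsPrimePower q = Σ ℕ λ p → Σ ℕ λ k → Prime p × 1 ≤ k × q ≡ p ^ k

module _ {c ℓ : Level} (F : CommutativeRing c ℓ) where
  open CommutativeRing F

  IsField : Set (c ⊔ ℓ)
  IsField = (¬ (0# ≈ 1#)) × (∀ x → ¬ (x ≈ 0#) → ∃ λ y → x * y ≈ 1#)

  HasCard : ℕ → Set (c ⊔ ℓ)
  HasCard q = Bijection (≡.setoid (Fin q)) setoid

  _≈ᵥ_ : {b : ℕ} → Vector Carrier b → Vector Carrier b → Set ℓ
  x ≈ᵥ y = ∀ i → x i ≈ y i

  IsInvertibleLinear : {b : ℕ} → (Vector Carrier b → Vector Carrier b) → Set (c ⊔ ℓ)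
  IsInvertibleLinear {b} T =
    (∀ x y → x ≈ᵥ y → T x ≈ᵥ T y)
    × (∀ x y → T (λ i → x i + y i) ≈ᵥ (λ i → T x i + T y i))
    × (∀ a x → T (λ i → a * x i) ≈ᵥ (λ i → a * T x i))
    × Σ (Vector Carrier b → Vector Carrier b) λ S →
        (∀ x → S (T x) ≈ᵥ x) × (∀ x → T (S x) ≈ᵥ x)

-- Fix a pivot coordinate o. For j ≢ o the transvection x ↦ x + a·x_j·e_o is an invertible linear
-- map. Handle the coordinates j ≢ o one at a time, keeping the invariant that any two points of V
-- which agree on the coordinates not yet handled differ at o. If x_j ≠ y_j, exactly one scalar a
-- makes the images of x and y agree at o; if x_j = y_j, the transvection preserves the invariant for
-- every a. There are C(|V|,2) < q pairs, so some a avoids all bad values. Once every coordinate has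
-- been handled, coordinate o alone separates the points.
module Submission where

open import Defs
open import Level using (Level; _⊔_)
open import Data.Nat as Nat using (ℕ; suc; _≤_; _<_)
open import Data.Nat.Properties using (≮⇒≥; <⇒≱)
open import Data.Nat.Combinatorics using (_C_; nC1≡n; nCk+nC[k+1]≡[n+1]C[k+1])
open import Data.Fin as Fin using (Fin; fromℕ<)
open import Data.Fin.Properties using (pigeonhole; <-irrefl) renaming (any? to Fin-any?)
open import Data.List using (List; []; _∷_; _++_; map; length; lookup; allFin)
open import Data.List.Properties using (length-map; length-++; map-∘)
open import Data.List.Relation.Unary.All as All using (All; []; _∷_)
import Data.List.Relation.Unary.All.Properties as Allₚ
import Data.List.Relation.Unary.Any as Any
open import Data.List.Relation.Unary.Any.Properties using (lookup-index)
open import Data.List.Relation.Unary.AllPairs as AllPairs using (AllPairs; []; _∷_)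
import Data.List.Relation.Unary.AllPairs.Properties as AllPairsₚ
open import Data.List.Membership.Propositional.Properties using (∈-allFin)
open import Data.Product using (Σ; ∃; _×_; _,_; proj₁; proj₂)
open import Data.Vec.Functional using (Vector)
open import Function using (_∘_; id)
open import Function.Bundles using (Bijection; Injection)
open import Function.Properties.Bijection using (Bijection⇒Inverse)
open import Function.Properties.Inverse using (Inverse⇒Injection)
import Function.Properties.Inverse as Inverse
open import Relation.Binary using (Setoid; Decidable)
open import Relation.Binary.PropositionalEquality as ≡ using (_≡_; _≢_)
open import Relation.Nullary using (¬_; yes; no; ¬?; contradiction)
open import Relation.Nullary.Decidable using (decidable-stable; via-injection)
open import Algebra.Bundles using (CommutativeRing)

module _ {a b} {A : Set a} {B : Set b} where

  pairsWith : (A → A → B) → List A → List B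
  pairsWith f []       = []
  pairsWith f (x ∷ xs) = map (f x) xs ++ pairsWith f xs

  length-pairsWith : ∀ f xs → length (pairsWith f xs) ≡ length xs C 2
  length-pairsWith f []       = ≡.refl
  length-pairsWith f (x ∷ xs) = begin
    length (map (f x) xs ++ pairsWith f xs)          ≡⟨ length-++ (map (f x) xs) ⟩
    length (map (f x) xs) + length (pairsWith f xs)
      ≡⟨ ≡.cong₂ _+_ (length-map (f x) xs) (length-pairsWith f xs) ⟩
    length xs + length xs C 2                        ≡⟨ ≡.cong (_+ length xs C 2) (nC1≡n (length xs)) ⟨
    length xs C 1 + length xs C 2                    ≡⟨ nCk+nC[k+1]≡[n+1]C[k+1] (length xs) 1 ⟩
    suc (length xs) C 2                              ∎
    where open ≡.≡-Reasoning; open Nat using (_+_)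

  All-pairsWith⁻ : ∀ {p} {P : B → Set p} f xs → All P (pairsWith f xs) → AllPairs (λ x y → P (f x y)) xs
  All-pairsWith⁻ f []       _   = []
  All-pairsWith⁻ f (x ∷ xs) all with Allₚ.++⁻ (map (f x) xs) all
  ... | head , rest = Allₚ.map⁻ head ∷ All-pairsWith⁻ f xs rest

module _ {a ℓ n} {S : Setoid a ℓ} (ι : Injection (≡.setoid (Fin n)) S) where
  open Setoid S using (_≈_; sym; trans; reflexive)
  open Injection ι using (to; injective)
  open import Data.List.Membership.Setoid S using (_∈_; _∉_)

  covering-length : ∀ {xs} → (∀ i → to i ∈ xs) → n ≤ length xs
  covering-length {xs} cover = ≮⇒≥ λ xs<n →
    let i , j , i<j , same-index = pigeonhole xs<n (Any.index ∘ cover)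
        same-image : to i ≈ to j
        same-image = trans (lookup-index (cover i))
                       (trans (reflexive (≡.cong (lookup xs) same-index)) (sym (lookup-index (cover j))))
    in <-irrefl (injective same-image) i<j

  ∃-∉ : Decidable _≈_ → ∀ xs → length xs < n → ∃ λ x → x ∉ xs
  ∃-∉ _≟_ xs xs<n with Fin-any? (λ i → ¬? (Any.any? (to i ≟_) xs))
  ... | yes (i , to[i]∉xs) = to i , to[i]∉xs
  ... | no  ¬∃ = contradiction (covering-length cover) (<⇒≱ xs<n)
    where
    cover : ∀ i → to i ∈ xs
    cover i = decidable-stable (Any.any? (to i ≟_) xs) (¬∃ ∘ (i ,_))

module LinearAutomorphism {c ℓ} (R : CommutativeRing c ℓ) (b : ℕ) where
  open CommutativeRing R

  infix 4 _≋_
  _≋_ : Vector Carrier b → Vector Carrier b → Set ℓ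
  _≋_ = _≈ᵥ_ R

  -- IsInvertibleLinear with a congruent inverse, which makes it closed under composition.
  record IsLinearAutomorphism (T : Vector Carrier b → Vector Carrier b) : Set (c ⊔ ℓ) where
    field
      cong         : ∀ x y → x ≋ y → T x ≋ T y
      +-homo       : ∀ x y → T (λ i → x i + y i) ≋ (λ i → T x i + T y i)
      *-homo       : ∀ a x → T (λ i → a * x i) ≋ (λ i → a * T x i)
      inverse      : Vector Carrier b → Vector Carrier b
      inverse-cong : ∀ x y → x ≋ y → inverse x ≋ inverse y
      inverseˡ     : ∀ x → inverse (T x) ≋ x
      inverseʳ     : ∀ x → T (inverse x) ≋ x

    isInvertibleLinear : IsInvertibleLinear R T
    isInvertibleLinear = cong , +-homo , *-homo , inverse , inverseˡ , inverseʳ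

  open IsLinearAutomorphism

  id-isLinearAutomorphism : IsLinearAutomorphism id
  id-isLinearAutomorphism = record
    { cong = λ _ _ x≋y → x≋y ; +-homo = λ _ _ _ → refl ; *-homo = λ _ _ _ → refl
    ; inverse = id ; inverse-cong = λ _ _ x≋y → x≋y ; inverseˡ = λ _ _ → refl ; inverseʳ = λ _ _ → refl
    }

  ∘-isLinearAutomorphism : ∀ {T U} → IsLinearAutomorphism T → IsLinearAutomorphism U →
                           IsLinearAutomorphism (U ∘ T)
  ∘-isLinearAutomorphism {T} {U} isT isU = record
    { cong         = λ x y x≋y → cong isU _ _ (cong isT x y x≋y)
    ; +-homo       = λ x y i → trans (cong isU _ _ (+-homo isT x y) i) (+-homo isU (T x) (T y) i)
    ; *-homo       = λ a x i → trans (cong isU _ _ (*-homo isT a x) i) (*-homo isU a (T x) i)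
    ; inverse      = inverse isT ∘ inverse isU
    ; inverse-cong = λ x y x≋y → inverse-cong isT _ _ (inverse-cong isU x y x≋y)
    ; inverseˡ     = λ x i → trans (inverse-cong isT _ _ (inverseˡ isU (T x)) i) (inverseˡ isT x i)
    ; inverseʳ     = λ x i → trans (cong isU _ _ (inverseʳ isT (inverse isU x)) i) (inverseʳ isU x i)
    }

module Transvection {c ℓ} (R : CommutativeRing c ℓ) {b : ℕ} (o : Fin b) where
  open CommutativeRing R
  open LinearAutomorphism R b
  open import Algebra.Properties.CommutativeSemigroup +-commutativeSemigroup using (interchange)
  open import Algebra.Properties.CommutativeSemigroup *-commutativeSemigroup using (x∙yz≈y∙xz)
  open import Algebra.Properties.Group +-group using (y≈x\\z; //-rightDividesʳ)
  open import Algebra.Properties.Ring ring using (-‿distribʳ-*; +-cancelʳ)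
  open import Relation.Binary.Reasoning.Setoid setoid

  u+a*v≈u′+a*v′⇒a*[v-v′]≈u′-u : ∀ {u u′ a v v′} → u + a * v ≈ u′ + a * v′ → a * (v - v′) ≈ u′ - u
  u+a*v≈u′+a*v′⇒a*[v-v′]≈u′-u {u} {u′} {a} {v} {v′} eq = begin
    a * (v - v′)                        ≈⟨ distribˡ a v (- v′) ⟩
    a * v + a * - v′                    ≈⟨ +-congˡ (-‿distribʳ-* a v′) ⟨
    a * v - a * v′                      ≈⟨ +-congʳ (y≈x\\z u (a * v) (u′ + a * v′) eq) ⟩
    (- u + (u′ + a * v′)) - a * v′      ≈⟨ +-congʳ (+-assoc (- u) u′ (a * v′)) ⟨
    ((- u + u′) + a * v′) - a * v′      ≈⟨ //-rightDividesʳ (a * v′) (- u + u′) ⟩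
    - u + u′                            ≈⟨ +-comm (- u) u′ ⟩
    u′ - u                              ∎

  transvection : Fin b → Carrier → Vector Carrier b → Vector Carrier b
  transvection j a x i with i Fin.≟ o
  ... | yes _ = x o + a * x j
  ... | no  _ = x i

  transvection-pivot : ∀ j a x → transvection j a x o ≡ x o + a * x j
  transvection-pivot j a x with o Fin.≟ o
  ... | yes _   = ≡.refl
  ... | no  o≢o = contradiction ≡.refl o≢o

  transvection-off : ∀ j a x {i} → i ≢ o → transvection j a x i ≡ x i
  transvection-off j a x {i} i≢o with i Fin.≟ o
  ... | yes i≡o = contradiction i≡o i≢o
  ... | no  _   = ≡.refl

  transvection-cong : ∀ j a x y → x ≋ y → transvection j a x ≋ transvection j a y
  transvection-cong j a x y x≋y i with i Fin.≟ o
  ... | yes _ = +-cong (x≋y o) (*-congˡ (x≋y j))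
  ... | no  _ = x≋y i

  transvection-+-homo : ∀ j a x y →
    transvection j a (λ i → x i + y i) ≋ (λ i → transvection j a x i + transvection j a y i)
  transvection-+-homo j a x y i with i Fin.≟ o
  ... | no  _ = refl
  ... | yes _ = begin
    (x o + y o) + a * (x j + y j)      ≈⟨ +-congˡ (distribˡ a (x j) (y j)) ⟩
    (x o + y o) + (a * x j + a * y j)  ≈⟨ interchange (x o) (y o) (a * x j) (a * y j) ⟩
    (x o + a * x j) + (y o + a * y j)  ∎

  transvection-*-homo : ∀ j a s x → transvection j a (λ i → s * x i) ≋ (λ i → s * transvection j a x i)
  transvection-*-homo j a s x i with i Fin.≟ o
  ... | no  _ = refl
  ... | yes _ = begin
    s * x o + a * (s * x j)  ≈⟨ +-congˡ (x∙yz≈y∙xz a s (x j)) ⟩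
    s * x o + s * (a * x j)  ≈⟨ distribˡ s (x o) (a * x j) ⟨
    s * (x o + a * x j)      ∎

  transvection-inverse : ∀ {j} → j ≢ o → ∀ {s t} → s + t ≈ 0# →
                         ∀ x → transvection j t (transvection j s x) ≋ x
  transvection-inverse {j} j≢o {s} {t} s+t≈0 x i with i Fin.≟ o
  ... | no  i≢o    = reflexive (transvection-off j s x i≢o)
  ... | yes ≡.refl = begin
    transvection j s x o + t * transvection j s x j
      ≡⟨ ≡.cong₂ (λ u v → u + t * v) (transvection-pivot j s x) (transvection-off j s x j≢o) ⟩
    (x o + s * x j) + t * x j  ≈⟨ +-assoc (x o) (s * x j) (t * x j) ⟩
    x o + (s * x j + t * x j)  ≈⟨ +-congˡ (distribʳ (x j) s t) ⟨
    x o + (s + t) * x j        ≈⟨ +-congˡ (*-congʳ s+t≈0) ⟩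
    x o + 0# * x j             ≈⟨ +-congˡ (zeroˡ (x j)) ⟩
    x o + 0#                   ≈⟨ +-identityʳ (x o) ⟩
    x o                        ∎

  transvection-isLinearAutomorphism : ∀ {j} → j ≢ o → ∀ a → IsLinearAutomorphism (transvection j a)
  transvection-isLinearAutomorphism {j} j≢o a = record
    { cong         = transvection-cong j a
    ; +-homo       = transvection-+-homo j a
    ; *-homo       = transvection-*-homo j a
    ; inverse      = transvection j (- a)
    ; inverse-cong = transvection-cong j (- a)
    ; inverseˡ     = transvection-inverse j≢o (-‿inverseʳ a)
    ; inverseʳ     = transvection-inverse j≢o (-‿inverseˡ a)
    }

  transvection-reflects : ∀ j a {x y} → x j ≈ y j → ∀ {i} →
                          transvection j a x i ≈ transvection j a y i → x i ≈ y i
  transvection-reflects j a {x} {y} xj≈yj {i} eq with i Fin.≟ o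
  ... | no  _      = eq
  ... | yes ≡.refl = +-cancelʳ (a * x j) (x o) (y o) (trans eq (+-congˡ (*-congˡ (sym xj≈yj))))

  transvection-pivot-agreement : ∀ j a {x y} → transvection j a x o ≈ transvection j a y o →
                                 a * (x j - y j) ≈ y o - x o
  transvection-pivot-agreement j a {x} {y} eq = u+a*v≈u′+a*v′⇒a*[v-v′]≈u′-u (begin
    x o + a * x j              ≡⟨ transvection-pivot j a x ⟨
    transvection j a x o       ≈⟨ eq ⟩
    transvection j a y o       ≡⟨ transvection-pivot j a y ⟩
    y o + a * y j              ∎)

module Separation {c ℓ} (F : CommutativeRing c ℓ) (isField : IsField F)
                  (_≟_ : Decidable (CommutativeRing._≈_ F))
                  {q : ℕ} (ι : Injection (≡.setoid (Fin q)) (CommutativeRing.setoid F))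
                  {b : ℕ} (o : Fin b) where
  open CommutativeRing F
  open LinearAutomorphism F b
  open Transvection F o
  open import Algebra.Properties.Group +-group using (x∙y⁻¹≈ε⇒x≈y)
  open import Data.List.Membership.Setoid setoid using (_∉_)
  open import Relation.Binary.Reasoning.Setoid setoid

  AgreeOn : List (Fin b) → Vector Carrier b → Vector Carrier b → Set ℓ
  AgreeOn I x y = All (λ i → x i ≈ y i) I

  DifferOn : List (Fin b) → Vector Carrier b → Vector Carrier b → Set ℓ
  DifferOn I x y = ¬ AgreeOn I x y

  difference-invertible : ∀ {u v} → ¬ u ≈ v → ∃ λ w → (u - v) * w ≈ 1#
  difference-invertible {u} {v} u≉v = proj₂ isField (u - v) (u≉v ∘ x∙y⁻¹≈ε⇒x≈y u v)

  -- The only scalar a with transvection j a x o ≈ transvection j a y o, when x j ≉ y j;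
  -- if x j ≈ y j there is no such scalar and the value 0# is junk.
  badScalar : Fin b → Vector Carrier b → Vector Carrier b → Carrier
  badScalar j x y with x j ≟ y j
  ... | yes _    = 0#
  ... | no xj≉yj = (y o - x o) * proj₁ (difference-invertible xj≉yj)

  badScalar-unique : ∀ j a {x y} → ¬ x j ≈ y j →
                     transvection j a x o ≈ transvection j a y o → a ≈ badScalar j x y
  badScalar-unique j a {x} {y} xj≉yj eq with x j ≟ y j
  ... | yes xj≈yj = contradiction xj≈yj xj≉yj
  ... | no  xj≉yj′ with difference-invertible xj≉yj′
  ...   | w , [xj-yj]*w≈1 = begin
    a                      ≈⟨ *-identityʳ a ⟨
    a * 1#                 ≈⟨ *-congˡ [xj-yj]*w≈1 ⟨
    a * ((x j - y j) * w)  ≈⟨ *-assoc a (x j - y j) w ⟨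
    (a * (x j - y j)) * w  ≈⟨ *-congʳ (transvection-pivot-agreement j a eq) ⟩
    (y o - x o) * w        ∎

  transvection-separates : ∀ {j a I x y} → ¬ a ≈ badScalar j x y →
    DifferOn (o ∷ j ∷ I) x y → DifferOn (o ∷ I) (transvection j a x) (transvection j a y)
  transvection-separates {j} {a} {I} {x} {y} a≉bad differ (pivot-agrees ∷ agrees) =
    differ (reflects pivot-agrees ∷ xj≈yj ∷ All.map reflects agrees)
    where
    xj≈yj : x j ≈ y j
    xj≈yj = decidable-stable (x j ≟ y j) (λ xj≉yj → a≉bad (badScalar-unique j a xj≉yj pivot-agrees))
    reflects : ∀ {i} → transvection j a x i ≈ transvection j a y i → x i ≈ y i
    reflects = transvection-reflects j a {x} {y} xj≈yj

  separatingAutomorphism : ∀ I V → length V C 2 < q → AllPairs (DifferOn (o ∷ I)) V →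
    ∃ λ T → IsLinearAutomorphism T × AllPairs (λ x y → ¬ x o ≈ y o) (map T V)
  separatingAutomorphism [] V _ differ =
    id , id-isLinearAutomorphism , AllPairsₚ.map⁺ (AllPairs.map (λ differ xo≈yo → differ (xo≈yo ∷ [])) differ)
  separatingAutomorphism (j ∷ I) V bound differ with j Fin.≟ o
  ... | yes ≡.refl =
    separatingAutomorphism I V bound (AllPairs.map (λ differ agrees → differ (All.head agrees ∷ agrees)) differ)
  ... | no  j≢o =
    let a , a∉bad = ∃-∉ ι _≟_ (pairsWith (badScalar j) V)
                          (≡.subst (_< q) (≡.sym (length-pairsWith (badScalar j) V)) bound)
        τ = transvection j a
        T , isT , T-separates = separatingAutomorphism I (map τ V) (length-map-bound τ) (τ-preserves a a∉bad)
    in  T ∘ τ , ∘-isLinearAutomorphism (transvection-isLinearAutomorphism j≢o a) isT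
              , ≡.subst (AllPairs _) (≡.sym (map-∘ V)) T-separates
    where
    length-map-bound : ∀ f → length (map f V) C 2 < q
    length-map-bound f = ≡.subst (λ n → n C 2 < q) (≡.sym (length-map f V)) bound

    τ-preserves : ∀ a → a ∉ pairsWith (badScalar j) V →
                  AllPairs (DifferOn (o ∷ I)) (map (transvection j a) V)
    τ-preserves a a∉bad = AllPairsₚ.map⁺ (AllPairs.zipWith
      (λ (a≉bad , differ) → transvection-separates a≉bad differ)
      (All-pairsWith⁻ (badScalar j) V (Allₚ.¬Any⇒All¬ _ a∉bad) , differ))

lemma2p1 : {c ℓ : Level} (q : ℕ) → IsPrimePower q
    → (F : CommutativeRing c ℓ) → IsField F → HasCard F q
    → (b : ℕ) → (hb : 1 ≤ b)
    → (V : List (Vector (CommutativeRing.Carrier F) b))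
    → AllPairs (λ x y → ¬ (_≈ᵥ_ F x y)) V
    → (length V) C 2 < q
    → Σ (Vector (CommutativeRing.Carrier F) b → Vector (CommutativeRing.Carrier F) b) λ T →
        IsInvertibleLinear F T
        × AllPairs (λ x y → ¬ (CommutativeRing._≈_ F (x (fromℕ< hb)) (y (fromℕ< hb)))) (map T V)
lemma2p1 q _ F isField card b hb V distinct bound =
  let T , isT , separates = separatingAutomorphism (allFin b) V bound (AllPairs.map differ-everywhere distinct)
  in  T , IsLinearAutomorphism.isInvertibleLinear isT , separates
  where
  open CommutativeRing F using (_≈_)
  open LinearAutomorphism F b using (module IsLinearAutomorphism)

  _≟_ : Decidable _≈_
  _≟_ = via-injection (Inverse⇒Injection (Inverse.sym (Bijection⇒Inverse card))) Fin._≟_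

  open Separation F isField _≟_ (Bijection.injection card) (fromℕ< hb)

  differ-everywhere : ∀ {x y} → ¬ _≈ᵥ_ F x y → DifferOn (fromℕ< hb ∷ allFin b) x y
  differ-everywhere x≉y (_ ∷ agrees) = x≉y λ i → All.lookup agrees (∈-allFin i)
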